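{- For all integers $\alpha\geq3$, $\beta\geq0$ and $n\geq0$, $\overline{p}(2^\alpha3^\beta n+5)\equiv0\pmod 8$.
   Context: An overpartition of $n$ is a partition of $n$ in which the first occurrence of each part may be overlined; $\overline{p}(n)$ is the number of overpartitions of $n$ ($\overline{p}(0)=1$), with generating function $\prod_{n\geq1}\frac{1+q^n}{1-q^n}$. -}

module Defs where

open import Data.Nat using (ℕ; zero; suc; _+_; _*_; _∸_; _<ᵇ_)
open import Data.Bool using (if_then_else_)

-- An overpartition of n is a partition of n in which the first occurrence
-- of each part may be overlined.  We count them by choosing, for each part
-- size s = 1, 2, ..., k, a multiplicity j ≥ 0; when j ≥ 1 there are exactly
-- two choices (first occurrence of s overlined or not).

mutual
  -- opB k n = number of overpartitions of n all of whose parts are ≤ k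
  opB : ℕ → ℕ → ℕ
  opB zero    zero    = 1
  opB zero    (suc n) = 0
  opB (suc k) n       = opB k n + 2 * multSum k (suc k) n n

  -- multSum k s r fuel = Σ_{i ≥ 1, i*s ≤ r} opB k (r ∸ i*s)
  -- (fuel ≥ r suffices since s ≥ 1 and each step removes s from r)
  multSum : ℕ → ℕ → ℕ → ℕ → ℕ
  multSum k s r zero       = 0
  multSum k s r (suc fuel) =
    if r <ᵇ s then 0 else (opB k (r ∸ s) + multSum k s (r ∸ s) fuel)

overpartitions : ℕ → ℕ
overpartitions n = opB n n

module Submission where

open import Defs
open import Data.Nat using (ℕ; _+_; _*_; _^_; _≤_)
open import Data.Nat.Divisibility using (_∣_)

open import Data.Bool using (true; false; if_then_else_)
open import Data.Nat using (zero; suc; _∸_; _<ᵇ_; _<_; _%_; z≤n; s≤s)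
open import Data.Nat.DivMod using (%-distribˡ-*; %-distribˡ-+; m%n<n; [m+kn]%n≡m%n; m∣n⇒o%n%m≡o%m)
open import Data.Nat.Divisibility using (divides)
open import Data.Nat.Properties
open import Algebra.Properties.CommutativeSemigroup +-commutativeSemigroup using (interchange)
open import Data.Nat.Tactic.RingSolver using (solve-∀)
open import Data.Product using (∃-syntax; _,_; map₂)
open import Function using (_∘_)
open import Relation.Binary.PropositionalEquality
open import Relation.Nullary using (yes; no; contradiction)
open import Relation.Nullary.Reflects using (ofʸ; ofⁿ)

-- An overpartition whose parts take d distinct values is one of the 2^d
-- overlinings of an ordinary partition, so modulo 8 only partitions with one or
-- two distinct part sizes matter: p̄(n) ≡ 2·d₁(n) + 4·d₂(n) (mod 8) for n > 0.
-- Let n ≡ 5 (mod 8) and let A count the factorizations n = u·w with u < w.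
-- Since n is not a square, d₁(n) = d(n) = 2A.  A partition with two part sizes
-- is n = u·x + v·y with u < v; the involution (u, x, v, y) ↦ (y, v − u, y + x, u)
-- fixes exactly the solutions of n = u·(2v − u), which match the factorizations
-- n = u·w with w − u even, i.e. all of them as n is odd.  Hence d₂(n) ≡ A (mod 2)
-- and p̄(n) ≡ 4A + 4A ≡ 0 (mod 8).

∑< : ℕ → (ℕ → ℕ) → ℕ
∑< zero    f = 0
∑< (suc n) f = f 0 + ∑< n (f ∘ suc)

syntax ∑< n (λ i → e) = ∑[ i < n ] e

∑-cong : ∀ n {f g : ℕ → ℕ} → (∀ i → f i ≡ g i) → ∑< n f ≡ ∑< n g
∑-cong zero    f≗g = refl
∑-cong (suc n) f≗g = cong₂ _+_ (f≗g 0) (∑-cong n (f≗g ∘ suc))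

∑-zero : ∀ n {f : ℕ → ℕ} → (∀ i → f i ≡ 0) → ∑< n f ≡ 0
∑-zero zero    f≗0 = refl
∑-zero (suc n) f≗0 = cong₂ _+_ (f≗0 0) (∑-zero n (f≗0 ∘ suc))

∑-+ : ∀ n (f g : ℕ → ℕ) → ∑[ i < n ] (f i + g i) ≡ ∑< n f + ∑< n g
∑-+ zero    f g = refl
∑-+ (suc n) f g = trans (cong (f 0 + g 0 +_) (∑-+ n (f ∘ suc) (g ∘ suc)))
                        (interchange (f 0) (g 0) _ _)

∑-* : ∀ n c (f : ℕ → ℕ) → ∑[ i < n ] (c * f i) ≡ c * ∑< n f
∑-* zero    c f = sym (*-zeroʳ c)
∑-* (suc n) c f = trans (cong (c * f 0 +_) (∑-* n c (f ∘ suc)))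
                        (sym (*-distribˡ-+ c (f 0) _))

∑-last : ∀ n (f : ℕ → ℕ) → ∑< (suc n) f ≡ ∑< n f + f n
∑-last zero    f = +-comm (f 0) 0
∑-last (suc n) f = trans (cong (f 0 +_) (∑-last n (f ∘ suc))) (sym (+-assoc (f 0) _ _))

∑-comm : ∀ m n (f : ℕ → ℕ → ℕ) →
  ∑[ i < m ] ∑[ j < n ] f i j ≡ ∑[ j < n ] ∑[ i < m ] f i j
∑-comm zero    n f = sym (∑-zero n (λ _ → refl))
∑-comm (suc m) n f = trans (cong (∑< n (f 0) +_) (∑-comm m n (f ∘ suc)))
                           (sym (∑-+ n (f 0) (λ j → ∑[ i < m ] f (suc i) j)))

∑-extend : ∀ {m n} (f : ℕ → ℕ) → m ≤ n → (∀ i → m ≤ i → f i ≡ 0) →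
  ∑< m f ≡ ∑< n f
∑-extend {n = n} f z≤n       f≗0 = sym (∑-zero n (λ i → f≗0 i z≤n))
∑-extend         f (s≤s m≤n) f≗0 =
  cong (f 0 +_) (∑-extend (f ∘ suc) m≤n (λ i → f≗0 (suc i) ∘ s≤s))

∑-even-odd : ∀ n (f : ℕ → ℕ) → ∑[ b < 2 * n ] f b ≡ ∑[ a < n ] (f (2 * a) + f (suc (2 * a)))
∑-even-odd zero    f = refl
∑-even-odd (suc n) f = begin
  ∑< (2 * suc n) f
    ≡⟨ cong (λ m → ∑< m f) (*-suc 2 n) ⟩
  f 0 + (f 1 + ∑[ b < 2 * n ] f (2 + b))
    ≡⟨ sym (+-assoc (f 0) (f 1) _) ⟩
  f 0 + f 1 + ∑[ b < 2 * n ] f (2 + b)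
    ≡⟨ cong (f 0 + f 1 +_) (∑-even-odd n (λ b → f (2 + b))) ⟩
  f 0 + f 1 + ∑[ a < n ] (f (2 + 2 * a) + f (3 + 2 * a))
    ≡⟨ cong (f 0 + f 1 +_) (∑-cong n (λ a → cong (λ b → f b + f (suc b)) (sym (*-suc 2 a)))) ⟩
  f 0 + f 1 + ∑[ a < n ] (f (2 * suc a) + f (suc (2 * suc a)))
    ∎
  where open ≡-Reasoning

∑∑-symmetric : ∀ n (F : ℕ → ℕ → ℕ) → (∀ a b → F a b ≡ F b a) →
  ∑[ a < n ] ∑[ b < n ] F a b ≡ ∑[ a < n ] F a a + 2 * ∑[ b < n ] ∑[ a < b ] F a b
∑∑-symmetric zero    F F-sym = refl
∑∑-symmetric (suc n) F F-sym = begin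
  (F 0 0 + X) + ∑[ a < n ] (F (suc a) 0 + ∑[ b < n ] F′ a b)
    ≡⟨ cong (F 0 0 + X +_) (∑-+ n (λ a → F (suc a) 0) (λ a → ∑< n (F′ a))) ⟩
  (F 0 0 + X) + (∑[ a < n ] F (suc a) 0 + ∑[ a < n ] ∑[ b < n ] F′ a b)
    ≡⟨ cong₂ (λ x y → F 0 0 + X + (x + y))
         (∑-cong n (λ a → F-sym (suc a) 0))
         (∑∑-symmetric n F′ (λ a b → F-sym (suc a) (suc b))) ⟩
  (F 0 0 + X) + (X + (D + 2 * T))
    ≡⟨ regroup (F 0 0) X D T ⟩
  (F 0 0 + D) + 2 * (X + T)
    ≡⟨ cong (λ y → F 0 0 + D + 2 * y)
         (sym (∑-+ n (λ b → F 0 (suc b)) (λ b → ∑[ a < b ] F′ a b))) ⟩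
  (F 0 0 + D) + 2 * ∑[ b < n ] (F 0 (suc b) + ∑[ a < b ] F′ a b)
    ∎
  where
  open ≡-Reasoning
  F′ : ℕ → ℕ → ℕ
  F′ a b = F (suc a) (suc b)
  X D T : ℕ
  X = ∑[ b < n ] F 0 (suc b)
  D = ∑[ a < n ] F′ a a
  T = ∑[ b < n ] ∑[ a < b ] F′ a b
  regroup : ∀ f x d t → (f + x) + (x + (d + 2 * t)) ≡ (f + d) + 2 * (x + t)
  regroup = solve-∀

∑⁴-symmetric : ∀ n (Φ : ℕ → ℕ → ℕ → ℕ → ℕ) →
  (∀ s a j i → Φ s a j i ≡ Φ j i s a) →
  ∃[ K ] ∑[ s < n ] ∑[ a < n ] ∑[ j < n ] ∑[ i < n ] Φ s a j i
         ≡ ∑[ s < n ] ∑[ a < n ] Φ s a s a + 2 * K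
∑⁴-symmetric n Φ Φ-sym = ∑< n T₂ + T₁ , (begin
  ∑[ s < n ] ∑[ a < n ] ∑[ j < n ] ∑[ i < n ] Φ s a j i
    ≡⟨ ∑-cong n (λ s → ∑-comm n n (λ a j → ∑< n (Φ s a j))) ⟩
  ∑[ s < n ] ∑[ j < n ] H s j
    ≡⟨ ∑∑-symmetric n H H-sym ⟩
  ∑[ s < n ] H s s + 2 * T₁
    ≡⟨ cong (_+ 2 * T₁) (∑-cong n (λ s →
         ∑∑-symmetric n (λ a i → Φ s a s i) (λ a i → Φ-sym s a s i))) ⟩
  ∑[ s < n ] (∑[ a < n ] Φ s a s a + 2 * T₂ s) + 2 * T₁
    ≡⟨ cong (_+ 2 * T₁) (trans (∑-+ n _ _) (cong (D +_) (∑-* n 2 T₂))) ⟩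
  (D + 2 * ∑< n T₂) + 2 * T₁
    ≡⟨ regroup D (∑< n T₂) T₁ ⟩
  D + 2 * (∑< n T₂ + T₁)
    ∎)
  where
  open ≡-Reasoning
  H : ℕ → ℕ → ℕ
  H s j = ∑[ a < n ] ∑[ i < n ] Φ s a j i
  H-sym : ∀ s j → H s j ≡ H j s
  H-sym s j = trans (∑-cong n (λ a → ∑-cong n (λ i → Φ-sym s a j i)))
                    (∑-comm n n (λ a i → Φ j i s a))
  T₁ D : ℕ
  T₁ = ∑[ j < n ] ∑[ s < j ] H s j
  D = ∑[ s < n ] ∑[ a < n ] Φ s a s a
  T₂ : ℕ → ℕ
  T₂ s = ∑[ i < n ] ∑[ a < i ] Φ s a s i
  regroup : ∀ d t u → (d + 2 * t) + 2 * u ≡ d + 2 * (t + u)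
  regroup = solve-∀

∑-triangle : ∀ n (G : ℕ → ℕ → ℕ) → (∀ s t → n ≤ t → G s t ≡ 0) →
  ∑[ t < n ] ∑[ s < t ] G s t ≡ ∑[ s < n ] ∑[ a < n ] G s (suc (s + a))
∑-triangle zero    G G≗0 = refl
∑-triangle (suc n) G G≗0 = begin
  ∑[ t < n ] (G 0 (suc t) + ∑[ s < t ] G′ s t)
    ≡⟨ ∑-+ n _ _ ⟩
  ∑[ t < n ] G 0 (suc t) + ∑[ t < n ] ∑[ s < t ] G′ s t
    ≡⟨ cong₂ _+_
         (∑-extend (λ a → G 0 (suc a)) (n≤1+n n) (λ a n≤a → G≗0 0 (suc a) (s≤s n≤a)))
         (∑-triangle n G′ (λ s t n≤t → G≗0 (suc s) (suc t) (s≤s n≤t))) ⟩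
  ∑[ a < suc n ] G 0 (suc a) + ∑[ s < n ] ∑[ a < n ] G′ s (suc (s + a))
    ≡⟨ cong (∑[ a < suc n ] G 0 (suc a) +_) (∑-cong n (λ s →
         ∑-extend (λ a → G′ s (suc (s + a))) (n≤1+n n)
           (λ a n≤a → G≗0 (suc s) _ (s≤s (≤-trans n≤a (m≤n+m a (suc s))))))) ⟩
  ∑[ a < suc n ] G 0 (suc a) + ∑[ s < n ] ∑[ a < suc n ] G′ s (suc (s + a))
    ∎
  where
  open ≡-Reasoning
  G′ : ℕ → ℕ → ℕ
  G′ s t = G (suc s) (suc t)

δ : ℕ → ℕ → ℕ
δ zero    zero    = 1
δ zero    (suc _) = 0
δ (suc _) zero    = 0
δ (suc a) (suc b) = δ a b

δ-≢ : ∀ {a b} → a ≢ b → δ a b ≡ 0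
δ-≢ {zero}  {zero}  a≢b = contradiction refl a≢b
δ-≢ {zero}  {suc b} a≢b = refl
δ-≢ {suc a} {zero}  a≢b = refl
δ-≢ {suc a} {suc b} a≢b = δ-≢ (a≢b ∘ cong suc)

δ-> : ∀ {a b} → b < a → δ a b ≡ 0
δ-> b<a = δ-≢ (λ a≡b → <-irrefl (sym a≡b) b<a)

δ-shift : ∀ x {d r} → d ≤ r → δ x (r ∸ d) ≡ δ (x + d) r
δ-shift x {zero}  {r}     _         = cong (λ y → δ y r) (sym (+-identityʳ x))
δ-shift x {suc d} {suc r} (s≤s d≤r) =
  trans (δ-shift x d≤r) (sym (cong (λ y → δ y (suc r)) (+-suc x d)))

atDiff : (ℕ → ℕ) → ℕ → ℕ → ℕ
atDiff f r d = if r <ᵇ d then 0 else f (r ∸ d)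

atDiff-< : ∀ f {r d} → r < d → atDiff f r d ≡ 0
atDiff-< f {r} {d} r<d with r <ᵇ d | <ᵇ-reflects-< r d
... | true  | _        = refl
... | false | ofⁿ r≮d = contradiction r<d r≮d

atDiff-≥ : ∀ f {r d} → d ≤ r → atDiff f r d ≡ f (r ∸ d)
atDiff-≥ f {r} {d} d≤r with r <ᵇ d | <ᵇ-reflects-< r d
... | true  | ofʸ r<d = contradiction d≤r (<⇒≱ r<d)
... | false | _       = refl

atDiff-cong : ∀ {f g} r d → (∀ m → m ≤ r → f m ≡ g m) → atDiff f r d ≡ atDiff g r d
atDiff-cong r d f≗g with r <ᵇ d
... | true  = refl
... | false = f≗g (r ∸ d) (m∸n≤m r d)

atDiff-+ : ∀ f g r d → atDiff (λ m → f m + g m) r d ≡ atDiff f r d + atDiff g r d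
atDiff-+ f g r d with r <ᵇ d
... | true  = refl
... | false = refl

atDiff-* : ∀ c f r d → atDiff (λ m → c * f m) r d ≡ c * atDiff f r d
atDiff-* c f r d with r <ᵇ d
... | true  = sym (*-zeroʳ c)
... | false = refl

atDiff-∑ : ∀ n (F : ℕ → ℕ → ℕ) r d →
  atDiff (λ m → ∑[ u < n ] F u m) r d ≡ ∑[ u < n ] atDiff (F u) r d
atDiff-∑ n F r d with r <ᵇ d
... | true  = sym (∑-zero n (λ _ → refl))
... | false = refl

atDiff-shift : ∀ f {r d} e → d ≤ r → atDiff f (r ∸ d) e ≡ atDiff f r (d + e)
atDiff-shift f {r} {d} e d≤r with r ∸ d <? e
... | yes r∸d<e = trans (atDiff-< f r∸d<e)
  (sym (atDiff-< f (subst (_< d + e) (m+[n∸m]≡n d≤r) (+-monoʳ-< d r∸d<e))))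
... | no  r∸d≮e = begin
  atDiff f (r ∸ d) e   ≡⟨ atDiff-≥ f (≮⇒≥ r∸d≮e) ⟩
  f (r ∸ d ∸ e)        ≡⟨ cong f (∸-+-assoc r d e) ⟩
  f (r ∸ (d + e))      ≡⟨ sym (atDiff-≥ f d+e≤r) ⟩
  atDiff f r (d + e)   ∎
  where
  open ≡-Reasoning
  d+e≤r : d + e ≤ r
  d+e≤r = subst (d + e ≤_) (m+[n∸m]≡n d≤r) (+-monoʳ-≤ d (≮⇒≥ r∸d≮e))

atDiff-δ : ∀ x r d → atDiff (δ x) r d ≡ δ (x + d) r
atDiff-δ x r d with r <? d
... | yes r<d = trans (atDiff-< (δ x) r<d) (sym (δ-> (<-≤-trans r<d (m≤n+m d x))))
... | no  r≮d = trans (atDiff-≥ (δ x) (≮⇒≥ r≮d)) (δ-shift x (≮⇒≥ r≮d))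

-- Σ_{i ≥ 1} f (n − i·s): the part s added with multiplicity i to what f counts.
withPart : (ℕ → ℕ) → ℕ → ℕ → ℕ
withPart f s n = ∑[ i < n ] atDiff f n (s * suc i)

withPart-cong : ∀ {f g} s n → (∀ m → f m ≡ g m) → withPart f s n ≡ withPart g s n
withPart-cong s n f≗g = ∑-cong n (λ i → atDiff-cong n (s * suc i) (λ m _ → f≗g m))

withPart-+ : ∀ f g s n → withPart (λ m → f m + g m) s n ≡ withPart f s n + withPart g s n
withPart-+ f g s n = trans (∑-cong n (λ i → atDiff-+ f g n (s * suc i))) (∑-+ n _ _)

withPart-* : ∀ c f s n → withPart (λ m → c * f m) s n ≡ c * withPart f s n
withPart-* c f s n = trans (∑-cong n (λ i → atDiff-* c f n (s * suc i))) (∑-* n c _)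

withPart-δ : ∀ x s n → withPart (δ x) s n ≡ ∑[ i < n ] δ (x + s * suc i) n
withPart-δ x s n = ∑-cong n (λ i → atDiff-δ x n (s * suc i))

multSum≡∑atDiff : ∀ k s r fuel →
  multSum k (suc s) r fuel ≡ ∑[ i < fuel ] atDiff (opB k) r (suc s * suc i)
multSum≡∑atDiff k s r zero = refl
multSum≡∑atDiff k s r (suc fuel) with r <ᵇ suc s | <ᵇ-reflects-< r (suc s)
... | true  | ofʸ r<s = sym (∑-zero (suc fuel) (λ i →
  atDiff-< (opB k) (<-≤-trans r<s (m≤m*n (suc s) (suc i)))))
... | false | ofⁿ r≮s = cong₂ _+_ (sym first)
  (trans (multSum≡∑atDiff k s (r ∸ suc s) fuel) (∑-cong fuel later))
  where
  s≤r : suc s ≤ r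
  s≤r = ≮⇒≥ r≮s
  first : atDiff (opB k) r (suc s * 1) ≡ opB k (r ∸ suc s)
  first = trans (cong (atDiff (opB k) r) (*-identityʳ (suc s))) (atDiff-≥ (opB k) s≤r)
  later : ∀ i → atDiff (opB k) (r ∸ suc s) (suc s * suc i) ≡ atDiff (opB k) r (suc s * suc (suc i))
  later i = trans (atDiff-shift (opB k) (suc s * suc i) s≤r)
                  (cong (atDiff (opB k) r) (sym (*-suc (suc s) (suc i))))

-- opB k n = Σ_d 2^d · #{partitions of n into parts ≤ k with d distinct sizes};
-- oneSize and twoSizes are the counts for d = 1, 2 and rest is the remainder over 8.
oneSize : ℕ → ℕ → ℕ
oneSize k n = ∑[ s < k ] withPart (δ 0) (suc s) n

twoSizes : ℕ → ℕ → ℕ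
twoSizes k n = ∑[ t < k ] withPart (oneSize t) (suc t) n

rest : ℕ → ℕ → ℕ
rest zero    n = 0
rest (suc k) n = rest k n + withPart (twoSizes k) (suc k) n + 2 * withPart (rest k) (suc k) n

opB-mod8 : ∀ k n → opB k n ≡ δ 0 n + 2 * oneSize k n + 4 * twoSizes k n + 8 * rest k n
opB-mod8 zero    zero    = refl
opB-mod8 zero    (suc n) = refl
opB-mod8 (suc k) n = begin
  opB k n + 2 * multSum k (suc k) n n
    ≡⟨ cong₂ (λ x y → x + 2 * y) (opB-mod8 k n)
         (trans (multSum≡∑atDiff k k n n) (withPart-cong (suc k) n (opB-mod8 k))) ⟩
  (E + 2 * O + 4 * T + 8 * R)
    + 2 * withPart (λ m → δ 0 m + 2 * oneSize k m + 4 * twoSizes k m + 8 * rest k m) (suc k) n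
    ≡⟨ cong (λ w → E + 2 * O + 4 * T + 8 * R + 2 * w) linear ⟩
  (E + 2 * O + 4 * T + 8 * R) + 2 * (wE + 2 * wO + 4 * wT + 8 * wR)
    ≡⟨ regroup E O T R wE wO wT wR ⟩
  E + 2 * (O + wE) + 4 * (T + wO) + 8 * (R + wT + 2 * wR)
    ≡⟨ sym (cong₂ (λ x y → E + 2 * x + 4 * y + 8 * rest (suc k) n) (∑-last k _) (∑-last k _)) ⟩
  E + 2 * oneSize (suc k) n + 4 * twoSizes (suc k) n + 8 * rest (suc k) n
    ∎
  where
  open ≡-Reasoning
  E O T R wE wO wT wR : ℕ
  E = δ 0 n
  O = oneSize k n
  T = twoSizes k n
  R = rest k n
  wE = withPart (δ 0) (suc k) n
  wO = withPart (oneSize k) (suc k) n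
  wT = withPart (twoSizes k) (suc k) n
  wR = withPart (rest k) (suc k) n
  linear : withPart (λ m → δ 0 m + 2 * oneSize k m + 4 * twoSizes k m + 8 * rest k m) (suc k) n
         ≡ wE + 2 * wO + 4 * wT + 8 * wR
  linear = trans (withPart-+ (λ m → f₀ m + f₁ m + f₂ m) f₃ (suc k) n) (cong₂ _+_
    (trans (withPart-+ (λ m → f₀ m + f₁ m) f₂ (suc k) n) (cong₂ _+_
      (trans (withPart-+ f₀ f₁ (suc k) n) (cong (wE +_) (withPart-* 2 (oneSize k) (suc k) n)))
      (withPart-* 4 (twoSizes k) (suc k) n)))
    (withPart-* 8 (rest k) (suc k) n))
    where
    f₀ f₁ f₂ f₃ : ℕ → ℕ
    f₀ = δ 0
    f₁ m = 2 * oneSize k m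
    f₂ m = 4 * twoSizes k m
    f₃ m = 8 * rest k m
  regroup : ∀ e o t r we wo wt wr →
    (e + 2 * o + 4 * t + 8 * r) + 2 * (we + 2 * wo + 4 * wt + 8 * wr)
    ≡ e + 2 * (o + we) + 4 * (t + wo) + 8 * (r + wt + 2 * wr)
  regroup = solve-∀

oneSize≡∑∑δ : ∀ k {m B} → m ≤ B →
  oneSize k m ≡ ∑[ s < k ] ∑[ i < B ] δ (suc s * suc i) m
oneSize≡∑∑δ k {m} m≤B = ∑-cong k (λ s → trans (withPart-δ 0 (suc s) m)
  (∑-extend _ m≤B (λ i m≤i → δ-> (<-≤-trans (s≤s m≤i) (m≤n*m (suc i) (suc s))))))

twoSizes≡∑⁴δ : ∀ n → twoSizes n n
  ≡ ∑[ s < n ] ∑[ a < n ] ∑[ j < n ] ∑[ i < n ] δ (suc s * suc i + (2 + s + a) * suc j) n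
twoSizes≡∑⁴δ n = begin
  ∑[ t < n ] ∑[ j < n ] atDiff (oneSize t) n (suc t * suc j)
    ≡⟨ ∑-cong n (λ t → ∑-cong n (λ j → lowered t j)) ⟩
  ∑[ t < n ] ∑[ j < n ] ∑[ s < t ] ∑[ i < n ] δ (suc s * suc i + suc t * suc j) n
    ≡⟨ ∑-cong n (λ t → ∑-comm n t _) ⟩
  ∑[ t < n ] ∑[ s < t ] G s t
    ≡⟨ ∑-triangle n G vanish ⟩
  ∑[ s < n ] ∑[ a < n ] G s (suc (s + a))
    ∎
  where
  open ≡-Reasoning
  G : ℕ → ℕ → ℕ
  G s t = ∑[ j < n ] ∑[ i < n ] δ (suc s * suc i + suc t * suc j) n
  vanish : ∀ s t → n ≤ t → G s t ≡ 0
  vanish s t n≤t = ∑-zero n (λ j → ∑-zero n (λ i → δ-> (<-≤-trans (s≤s n≤t)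
    (≤-trans (m≤m*n (suc t) (suc j)) (m≤n+m _ (suc s * suc i))))))
  lowered : ∀ t j → atDiff (oneSize t) n (suc t * suc j)
    ≡ ∑[ s < t ] ∑[ i < n ] δ (suc s * suc i + suc t * suc j) n
  lowered t j = begin
    atDiff (oneSize t) n p
      ≡⟨ atDiff-cong n p (λ m m≤n → oneSize≡∑∑δ t m≤n) ⟩
    atDiff (λ m → ∑[ s < t ] ∑[ i < n ] δ (suc s * suc i) m) n p
      ≡⟨ atDiff-∑ t (λ s m → ∑[ i < n ] δ (suc s * suc i) m) n p ⟩
    ∑[ s < t ] atDiff (λ m → ∑[ i < n ] δ (suc s * suc i) m) n p
      ≡⟨ ∑-cong t (λ s → trans (atDiff-∑ n (λ i → δ (suc s * suc i)) n p)
                                (∑-cong n (λ i → atDiff-δ (suc s * suc i) n p))) ⟩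
    ∑[ s < t ] ∑[ i < n ] δ (suc s * suc i + p) n
      ∎
    where p = suc t * suc j

-- factorizations n = u·w with u = s + 1 < w = u + 1 + b
factorPairs : ℕ → ℕ
factorPairs n = ∑[ s < n ] ∑[ b < n ] δ (suc s * (2 + s + b)) n

oneSize-nonsquare : ∀ n → (∀ x → x * x ≢ n) → oneSize n n ≡ 2 * factorPairs n
oneSize-nonsquare n nonsquare = begin
  oneSize n n
    ≡⟨ oneSize≡∑∑δ n (≤-refl {n}) ⟩
  ∑[ s < n ] ∑[ i < n ] F s i
    ≡⟨ ∑∑-symmetric n F (λ s i → cong (λ m → δ m n) (*-comm (suc s) (suc i))) ⟩
  ∑[ s < n ] F s s + 2 * ∑[ t < n ] ∑[ s < t ] F s t
    ≡⟨ cong₂ (λ x y → x + 2 * y)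
         (∑-zero n {λ s → F s s} (λ s → δ-≢ (nonsquare (suc s))))
         (∑-triangle n F vanish) ⟩
  2 * factorPairs n
    ∎
  where
  open ≡-Reasoning
  F : ℕ → ℕ → ℕ
  F s i = δ (suc s * suc i) n
  vanish : ∀ s t → n ≤ t → F s t ≡ 0
  vanish s t n≤t = δ-> (<-≤-trans (s≤s n≤t) (m≤n*m (suc t) (suc s)))

odd-sum⇒even-product : ∀ a b → (a + b) % 2 ≡ 1 → a * b % 2 ≡ 0
odd-sum⇒even-product a b a+b-odd = trans (%-distribˡ-* a b 2)
  (residues (a % 2) (b % 2) (m%n<n a 2) (m%n<n b 2) (trans (sym (%-distribˡ-+ a b 2)) a+b-odd))
  where
  residues : ∀ x y → x < 2 → y < 2 → (x + y) % 2 ≡ 1 → x * y % 2 ≡ 0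
  residues 0 0 _ _ ()
  residues 0 1 _ _ _ = refl
  residues 1 0 _ _ _ = refl
  residues 1 1 _ _ ()
  residues (suc (suc x)) _ (s≤s (s≤s ())) _ _
  residues _ (suc (suc y)) _ (s≤s (s≤s ())) _

square%8≢5 : ∀ x → x * x % 8 ≢ 5
square%8≢5 x eq = residues (x % 8) (m%n<n x 8) (trans (sym (%-distribˡ-* x x 8)) eq)
  where
  residues : ∀ r → r < 8 → r * r % 8 ≢ 5
  residues 0 _ ()
  residues 1 _ ()
  residues 2 _ ()
  residues 3 _ ()
  residues 4 _ ()
  residues 5 _ ()
  residues 6 _ ()
  residues 7 _ ()
  residues (suc (suc (suc (suc (suc (suc (suc (suc r))))))))
           (s≤s (s≤s (s≤s (s≤s (s≤s (s≤s (s≤s (s≤s ()))))))))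

twoSizes-odd : ∀ n → n % 2 ≡ 1 → ∃[ K ] twoSizes n n ≡ factorPairs n + 2 * K
twoSizes-odd n n-odd = map₂
  (λ {K} pairing → trans (twoSizes≡∑⁴δ n) (trans pairing (cong (_+ 2 * K) (sym diagonal))))
  (∑⁴-symmetric n Φ Φ-sym)
  where
  open ≡-Reasoning
  -- n = u·x + v·y with u = s + 1, v = u + 1 + a, x = i + 1, y = j + 1
  Φ : ℕ → ℕ → ℕ → ℕ → ℕ
  Φ s a j i = δ (suc s * suc i + (2 + s + a) * suc j) n
  swap : ∀ s a j i → suc s * suc i + (2 + s + a) * suc j ≡ suc j * suc a + (2 + j + i) * suc s
  swap = solve-∀
  Φ-sym : ∀ s a j i → Φ s a j i ≡ Φ j i s a
  Φ-sym s a j i = cong (λ m → δ m n) (swap s a j i)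
  g : ℕ → ℕ → ℕ
  g s b = δ (suc s * (2 + s + b)) n
  vanish : ∀ s b → n ≤ b → g s b ≡ 0
  vanish s b n≤b = δ-> (<-≤-trans (s≤s (≤-trans n≤b (m≤n+m b (suc s))))
                                  (m≤n*m (2 + s + b) (suc s)))
  sum-odd : ∀ s a → (suc s + (2 + s + 2 * a)) % 2 ≡ 1
  sum-odd s a = trans (cong (_% 2) (twice s a)) ([m+kn]%n≡m%n 1 (suc s + a) 2)
    where
    twice : ∀ s a → suc s + (2 + s + 2 * a) ≡ 1 + (suc s + a) * 2
    twice = solve-∀
  even-vanish : ∀ s a → g s (2 * a) ≡ 0
  even-vanish s a = δ-≢ {suc s * (2 + s + 2 * a)} {n} (λ eq → 0≢1+n (trans
    (sym (odd-sum⇒even-product (suc s) (2 + s + 2 * a) (sum-odd s a)))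
    (trans (cong (_% 2) eq) n-odd)))
  diagonal-term : ∀ s a → suc s * suc a + (2 + s + a) * suc s ≡ suc s * (2 + s + suc (2 * a))
  diagonal-term = solve-∀
  diagonal : factorPairs n ≡ ∑[ s < n ] ∑[ a < n ] Φ s a s a
  diagonal = ∑-cong n λ s → begin
    ∑[ b < n ] g s b
      ≡⟨ ∑-extend (g s) (m≤n*m n 2) (vanish s) ⟩
    ∑[ b < 2 * n ] g s b
      ≡⟨ ∑-even-odd n (g s) ⟩
    ∑[ a < n ] (g s (2 * a) + g s (suc (2 * a)))
      ≡⟨ ∑-cong n (λ a → cong (_+ g s (suc (2 * a))) (even-vanish s a)) ⟩
    ∑[ a < n ] g s (suc (2 * a))
      ≡⟨ ∑-cong n (λ a → cong (λ m → δ m n) (sym (diagonal-term s a))) ⟩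
    ∑[ a < n ] Φ s a s a
      ∎

nonsquare-5mod8 : ∀ {n} → n % 8 ≡ 5 → ∀ x → x * x ≢ n
nonsquare-5mod8 n%8≡5 x eq = square%8≢5 x (trans (cong (_% 8) eq) n%8≡5)

odd-5mod8 : ∀ {n} → n % 8 ≡ 5 → n % 2 ≡ 1
odd-5mod8 {n} n%8≡5 = trans (sym (m∣n⇒o%n%m≡o%m 2 8 n (divides 4 refl))) (cong (_% 2) n%8≡5)

8∣overpartitions : ∀ n → n % 8 ≡ 5 → 8 ∣ overpartitions n
8∣overpartitions n n%8≡5 with twoSizes-odd n (odd-5mod8 {n} n%8≡5)
... | K , twoSizes≡ = divides (A + K + rest n n) (begin
  opB n n
    ≡⟨ opB-mod8 n n ⟩
  δ 0 n + 2 * oneSize n n + 4 * twoSizes n n + 8 * rest n n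
    ≡⟨ cong₂ (λ x y → x + 2 * y + 4 * twoSizes n n + 8 * rest n n)
         (δ-≢ (nonsquare 0)) (oneSize-nonsquare n nonsquare) ⟩
  0 + 2 * (2 * A) + 4 * twoSizes n n + 8 * rest n n
    ≡⟨ cong (λ z → 0 + 2 * (2 * A) + 4 * z + 8 * rest n n) twoSizes≡ ⟩
  0 + 2 * (2 * A) + 4 * (A + 2 * K) + 8 * rest n n
    ≡⟨ collect A K (rest n n) ⟩
  (A + K + rest n n) * 8
    ∎)
  where
  open ≡-Reasoning
  A : ℕ
  A = factorPairs n
  nonsquare : ∀ x → x * x ≢ n
  nonsquare = nonsquare-5mod8 {n} n%8≡5
  collect : ∀ a k r → 0 + 2 * (2 * a) + 4 * (a + 2 * k) + 8 * r ≡ (a + k + r) * 8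
  collect = solve-∀

corollary3p5 : (α β n : ℕ) → 3 ≤ α →
    8 ∣ overpartitions (2 ^ α * 3 ^ β * n + 5)
corollary3p5 (suc (suc (suc α))) β n _ = 8∣overpartitions (2 ^ (3 + α) * 3 ^ β * n + 5)
  (trans (cong (_% 8) (eightfold (2 ^ α) (3 ^ β) n)) ([m+kn]%n≡m%n 5 (2 ^ α * 3 ^ β * n) 8))
  where
  eightfold : ∀ x y z → 2 * (2 * (2 * x)) * y * z + 5 ≡ 5 + x * y * z * 8
  eightfold = solve-∀
corollary3p5 (suc zero)       β n (s≤s ())
corollary3p5 (suc (suc zero)) β n (s≤s (s≤s ()))
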